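{- For every integer $n \geq 2$, $b_R(P_2 \times P_n) = 2$, where $P_2 \times P_n$ is the cartesian product of the paths $P_2$ and $P_n$.
   Context: All graphs are finite and simple. $P_k$ is the path on $k$ vertices. The cartesian product $G_1 \times G_2$ has vertex set $V(G_1) \times V(G_2)$, with $(u_1,u_2)$ adjacent to $(v_1,v_2)$ iff either $u_1 = v_1$ and $u_2v_2 \in E(G_2)$, or $u_2 = v_2$ and $u_1v_1 \in E(G_1)$. A Roman dominating function on $G$ is a function $f: V(G) \to \{0,1,2\}$ such that every vertex $v$ with $f(v)=0$ has a neighbor $u$ with $f(u)=2$; its weight is $\sum_v f(v)$, and $\gamma_R(G)$ is the minimum weight of such a function. For a graph with maximum degree at least two, the Roman bondage number $b_R(G)$ is the minimum cardinality of a set $E' \subseteq E(G)$ with $\gamma_R(G - E') > \gamma_R(G)$, where $G-E'$ is obtained by deleting the edges of $E'$. -}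

module Defs where

open import Data.Nat using (ℕ; zero; suc; _+_; _*_; _≤_; _<_; _/_)
open import Data.Nat.Properties using (_≟_)
open import Data.Fin using (Fin; toℕ)
open import Data.Fin.Properties as FinP using ()
open import Data.Bool using (Bool; true; false; _∧_; _∨_; not)
open import Data.Nat.ListAction using (sum)
open import Data.List using (List; map; length; filter; cartesianProduct; allFin)
open import Data.Product using (Σ; ∃; _×_; _,_; proj₁; proj₂)
open import Relation.Nullary.Decidable using (⌊_⌋)
open import Relation.Binary.PropositionalEquality using (_≡_)
open import Data.Bool.Properties using () renaming (_≟_ to _≟B_)

-- A finite simple graph on a vertex type V, given by a duplicate-free,
-- complete list of its vertices and a Boolean adjacency relation.
-- (Only used for the concrete graphs P_2 × P_n below, where these
-- properties hold by construction.)
record Graph : Set₁ where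
  field
    V     : Set
    verts : List V
    adj   : V → V → Bool

open Graph public

pathAdj : (k : ℕ) → Fin k → Fin k → Bool
pathAdj k i j = ⌊ suc (toℕ i) ≟ toℕ j ⌋ ∨ ⌊ suc (toℕ j) ≟ toℕ i ⌋

P2×Pn : ℕ → Graph
P2×Pn n = record
  { V     = Fin 2 × Fin n
  ; verts = cartesianProduct (allFin 2) (allFin n)
  ; adj   = λ u v →
      (⌊ FinP._≟_ (proj₁ u) (proj₁ v) ⌋ ∧ pathAdj n (proj₂ u) (proj₂ v))
      ∨ (⌊ FinP._≟_ (proj₂ u) (proj₂ v) ⌋ ∧ pathAdj 2 (proj₁ u) (proj₁ v))
  }

IsRDF : (G : Graph) → (V G → ℕ) → Set
IsRDF G f = (∀ v → f v ≤ 2)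
          × (∀ v → f v ≡ 0 → Σ (V G) λ u → adj G v u ≡ true × f u ≡ 2)

weight : (G : Graph) → (V G → ℕ) → ℕ
weight G f = sum (map f (verts G))

IsRomanDomNum : Graph → ℕ → Set
IsRomanDomNum G k =
  (Σ (V G → ℕ) λ f → IsRDF G f × weight G f ≡ k)
  × (∀ f → IsRDF G f → k ≤ weight G f)

record EdgeSet (G : Graph) : Set where
  field
    mem     : V G → V G → Bool
    sym     : ∀ u v → mem u v ≡ mem v u
    subset  : ∀ u v → mem u v ≡ true → adj G u v ≡ true

open EdgeSet public

-- |E'|: ordered pairs in E' counted, divided by 2 (each edge counted twice).
card : (G : Graph) → EdgeSet G → ℕ
card G E = length (filter (λ p → mem E (proj₁ p) (proj₂ p) ≟B true)
                          (cartesianProduct (verts G) (verts G))) / 2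

deleteEdges : (G : Graph) → EdgeSet G → Graph
deleteEdges G E = record
  { V = V G ; verts = verts G
  ; adj = λ u v → adj G u v ∧ not (mem E u v) }

RaisesRDN : (G : Graph) → EdgeSet G → Set
RaisesRDN G E = Σ ℕ λ k → Σ ℕ λ k' →
  IsRomanDomNum G k × IsRomanDomNum (deleteEdges G E) k' × k < k'

IsRomanBondageNum : Graph → ℕ → Set
IsRomanBondageNum G b =
  (Σ (EdgeSet G) λ E → card G E ≡ b × RaisesRDN G E)
  × (∀ E → RaisesRDN G E → b ≤ card G E)

-- Read a function on P₂ × Pₙ column by column.  A potential depending on two consecutive
-- columns, checked by evaluation on all columns with entries in {0, 1, 2}, shows that every
-- Roman dominating function of P₂ × Pₙ has weight at least n + 1, and a zigzag of 2s attains
-- this.  Deleting the two rails between the first two columns splits off a K₂, which needs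
-- weight 2, from a copy of P₂ × Pₙ₋₁, so γ_R rises to n + 2.  Deleting a single edge never
-- raises γ_R: the zigzag, its mirror image and its shift by one column are Roman dominating
-- functions of weight n + 1, and no edge is used by all three of them.
module Submission where

open import Defs hiding (sym)
open import Data.Nat using (ℕ; zero; suc; _+_; _∸_; _/_; _≤_; _<_; _<?_; z≤n; s≤s; _≡ᵇ_; _≤ᵇ_)
open import Data.Nat.Properties
open import Data.Nat.ListAction using (sum)
open import Data.Bool using (Bool; true; false; _∧_; _∨_; not; T; if_then_else_)
open import Data.Bool.Properties
  using (T-∧; T-∨; ∧-comm; ∧-identityʳ; ∧-zeroʳ; ∨-zeroʳ) renaming (_≟_ to _≟B_)
open import Data.Fin using (Fin; zero; suc; toℕ; fromℕ<; inject₁)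
open import Data.Fin.Properties using (toℕ-fromℕ<; toℕ<n; toℕ-inject₁)
import Data.Fin.Properties as FinP
open import Relation.Nullary using (Dec; yes; no; ¬_; contradiction)
open import Relation.Nullary.Decidable using (⌊_⌋; isYes≗does; dec-true)
open import Data.List using (List; []; _∷_; _++_; length; map; tabulate; allFin; filter; cartesianProduct)
open import Data.List.Membership.Propositional using (_∈_)
open import Data.List.Membership.Propositional.Properties
  using (∈-filter⁺; ∈-filter⁻; ∈-cartesianProduct⁺; ∈-allFin)
open import Data.List.Relation.Unary.Any using (here; there; index; _─_)
open import Data.List.Relation.Unary.All as All using ([]; _∷_)
open import Data.List.Relation.Unary.AllPairs using ([]; _∷_)
open import Data.List.Relation.Unary.Unique.Propositional using (Unique)
import Data.List.Relation.Unary.Unique.Propositional.Properties as Unique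
open import Data.List.Properties using (map-++; ++-identityʳ; map-tabulate; length-tabulate; length-removeAt′)
open import Data.Nat.ListAction.Properties using (sum-++)
open import Data.Nat.DivMod using (/-monoˡ-≤)
open import Algebra.Properties.CommutativeSemigroup +-commutativeSemigroup
  using (x∙yz≈y∙xz) renaming (interchange to +-interchange)
open import Function.Base using (_∘_; id)
open import Data.Product using (Σ; _×_; _,_; proj₁; proj₂; swap)
open import Data.Sum using (_⊎_; inj₁; inj₂)
open import Data.Unit using (⊤; tt)
open import Function.Bundles using (Equivalence)
open import Relation.Binary.PropositionalEquality
open import Relation.Binary.Definitions using (DecidableEquality)
open import Data.Product.Properties using (≡-dec)

T-∧-split : ∀ {a b} → T (a ∧ b) → T a × T b
T-∧-split = Equivalence.to T-∧

T-∧-intro : ∀ {a b} → T a → T b → T (a ∧ b)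
T-∧-intro ta tb = Equivalence.from T-∧ (ta , tb)

T-∨-split : ∀ {a b} → T (a ∨ b) → T a ⊎ T b
T-∨-split = Equivalence.to T-∨

T-∨-introˡ : ∀ {a} b → T a → T (a ∨ b)
T-∨-introˡ {true} _ _ = tt

T-∨-introʳ : ∀ a {b} → T b → T (a ∨ b)
T-∨-introʳ true  _ = tt
T-∨-introʳ false h = h

T-⇒ : ∀ {a b} → T (not a ∨ b) → T a → T b
T-⇒ {true} h _ = h

⌊⌋-true : ∀ {A : Set} (a? : Dec A) → A → ⌊ a? ⌋ ≡ true
⌊⌋-true a? a = trans (isYes≗does a?) (dec-true a? a)

⌊⌋-sound : ∀ {A : Set} (a? : Dec A) → ⌊ a? ⌋ ≡ true → A
⌊⌋-sound (yes a) _ = a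

∧-true : ∀ {a b} → (a ∧ b) ≡ true → a ≡ true × b ≡ true
∧-true {true} h = refl , h

∨-true : ∀ a {b} → (a ∨ b) ≡ true → a ≡ true ⊎ b ≡ true
∨-true true  _ = inj₁ refl
∨-true false h = inj₂ h

kept-two : ∀ {a} x → T (a ∧ (x ≡ᵇ 2)) → T a × x ≡ 2
kept-two {true} x h = tt , ≡ᵇ⇒≡ x 2 h

Column : Set
Column = ℕ × ℕ

emptyColumn : Column
emptyColumn = 0 , 0

entry : Fin 2 → Column → ℕ
entry zero    = proj₁
entry (suc _) = proj₂

otherRow : Fin 2 → Fin 2
otherRow zero    = suc zero
otherRow (suc _) = zero

columnWeight : Column → ℕ
columnWeight (a , b) = a + b

totalWeight : List Column → ℕ
totalWeight cs = sum (map columnWeight cs)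

columnAt : List Column → ℕ → Column
columnAt []       _       = emptyColumn
columnAt (c ∷ cs) zero    = c
columnAt (c ∷ cs) (suc k) = columnAt cs k

bounded : Column → Bool
bounded (a , b) = (a ≤ᵇ 2) ∧ (b ≤ᵇ 2)

bounded-intro : ∀ c → entry zero c ≤ 2 → entry (suc zero) c ≤ 2 → T (bounded c)
bounded-intro c a≤2 b≤2 = T-∧-intro (≤⇒≤ᵇ a≤2) (≤⇒≤ᵇ b≤2)

bounded-elim : ∀ c r → T (bounded c) → entry r c ≤ 2
bounded-elim c zero       h = ≤ᵇ⇒≤ _ 2 (proj₁ (T-∧-split {entry zero c ≤ᵇ 2} h))
bounded-elim c (suc zero) h = ≤ᵇ⇒≤ _ 2 (proj₂ (T-∧-split {entry zero c ≤ᵇ 2} h))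

-- rung j is the edge inside column j; rail r j joins columns j − 1 and j in row r.
data Slot : Set where
  rung : ℕ → Slot
  rail : Fin 2 → ℕ → Slot

Layout : Set
Layout = Slot → Bool

everySlot : Layout
everySlot _ = true

-- Row r of column c, which sits between the columns p and c', is nonzero or sees a 2
-- along a kept edge.
covered : Bool → Bool → Bool → Fin 2 → Column → Column → Column → Bool
covered rungKept leftKept rightKept r p c c' =
  not (entry r c ≡ᵇ 0)
  ∨ rungKept ∧ (entry (otherRow r) c ≡ᵇ 2)
  ∨ leftKept ∧ (entry r p ≡ᵇ 2)
  ∨ rightKept ∧ (entry r c' ≡ᵇ 2)

covered-intro : ∀ r p c c' → (entry r c ≡ 0 → entry (otherRow r) c ≡ 2 ⊎ entry r p ≡ 2 ⊎ entry r c' ≡ 2) →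
  T (covered true true true r p c c')
covered-intro r p c c' h with entry r c ≡ᵇ 0 in eq
... | false = tt
... | true with h (≡ᵇ⇒≡ _ 0 (subst T (sym eq) tt))
...   | inj₁ e        = T-∨-introˡ _ (≡⇒≡ᵇ _ 2 e)
...   | inj₂ (inj₁ e) = T-∨-introʳ (entry (otherRow r) c ≡ᵇ 2) (T-∨-introˡ _ (≡⇒≡ᵇ _ 2 e))
...   | inj₂ (inj₂ e) =
  T-∨-introʳ (entry (otherRow r) c ≡ᵇ 2) (T-∨-introʳ (entry r p ≡ᵇ 2) (≡⇒≡ᵇ _ 2 e))

covered-elim : ∀ rungKept leftKept rightKept r p c c' → T (covered rungKept leftKept rightKept r p c c') →
  entry r c ≡ 0 →
  (T rungKept × entry (otherRow r) c ≡ 2) ⊎ (T leftKept × entry r p ≡ 2) ⊎ (T rightKept × entry r c' ≡ 2)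
covered-elim rungKept leftKept rightKept r p c c' h c₀ rewrite c₀ with T-∨-split {rungKept ∧ _} h
... | inj₁ h′ = inj₁ (kept-two _ h′)
... | inj₂ h′ with T-∨-split {leftKept ∧ _} h′
...   | inj₁ h″ = inj₂ (inj₁ (kept-two _ h″))
...   | inj₂ h″ = inj₂ (inj₂ (kept-two _ h″))

emptyColumn-entry≢2 : ∀ r → entry r emptyColumn ≢ 2
emptyColumn-entry≢2 zero       ()
emptyColumn-entry≢2 (suc zero) ()

romanColumn : Bool → (Fin 2 → Bool) → (Fin 2 → Bool) → Column → Column → Column → Bool
romanColumn rungKept leftKept rightKept p c c' =
  bounded c
  ∧ covered rungKept (leftKept zero) (rightKept zero) zero p c c'
  ∧ covered rungKept (leftKept (suc zero)) (rightKept (suc zero)) (suc zero) p c c'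

romanAt : Layout → ℕ → Column → Column → Column → Bool
romanAt L j = romanColumn (L (rung j)) (λ r → L (rail r j)) (λ r → L (rail r (suc j)))

romanAt-bounded : ∀ L j p c c' → T (romanAt L j p c c') → T (bounded c)
romanAt-bounded L j p c c' h = proj₁ (T-∧-split {bounded c} h)

romanAt-covered : ∀ L j p c c' → T (romanAt L j p c c') →
  ∀ r → T (covered (L (rung j)) (L (rail r j)) (L (rail r (suc j))) r p c c')
romanAt-covered L j p c c' h zero       = proj₁ (T-∧-split {topRow} (proj₂ (T-∧-split {bounded c} h)))
  where topRow = covered (L (rung j)) (L (rail zero j)) (L (rail zero (suc j))) zero p c c'
romanAt-covered L j p c c' h (suc zero) = proj₂ (T-∧-split {topRow} (proj₂ (T-∧-split {bounded c} h)))
  where topRow = covered (L (rung j)) (L (rail zero j)) (L (rail zero (suc j))) zero p c c'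

-- The columns cs, placed from index j on after the column p, satisfy the Roman condition
-- in the grid whose edges are the slots kept by L.
RomanColumns : Layout → ℕ → Column → List Column → Set
RomanColumns L j p []       = ⊤
RomanColumns L j p (c ∷ cs) = T (romanAt L j p c (columnAt cs 0)) × RomanColumns L (suc j) c cs

romanColumns-at : ∀ L j p cs → RomanColumns L j p cs → ∀ k → k < length cs →
  T (romanAt L (j + k) (columnAt (p ∷ cs) k) (columnAt cs k) (columnAt cs (suc k)))
romanColumns-at L j p (c ∷ cs) (h , _) zero _ rewrite +-identityʳ j = h
romanColumns-at L j p (c ∷ cs) (_ , hs) (suc k) (s≤s k<n) rewrite +-suc j k =
  romanColumns-at L (suc j) c cs hs k k<n

romanColumns-from-at : ∀ L j p cs →
  (∀ k → k < length cs → T (romanAt L (j + k) (columnAt (p ∷ cs) k) (columnAt cs k) (columnAt cs (suc k)))) →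
  RomanColumns L j p cs
romanColumns-from-at L j p []       h = tt
romanColumns-from-at L j p (c ∷ cs) h =
  subst (λ i → T (romanAt L i p c (columnAt cs 0))) (+-identityʳ j) (h 0 (s≤s z≤n)) ,
  romanColumns-from-at L (suc j) c cs λ k k<n →
    subst (λ i → T (romanAt L i (columnAt (c ∷ cs) k) (columnAt cs k) (columnAt cs (suc k))))
          (+-suc j k) (h (suc k) (s≤s k<n))

-- A lower bound by a potential

-- potential p c − 1 is a lower bound, verified below, for the excess (weight minus number of
-- columns) of every Roman column sequence that starts with c right after p.
potential : Column → Column → ℕ
potential p c =
  if 3 ≤ᵇ columnWeight c then 3 else if columnWeight c ≡ᵇ 2 then 2 else 2 ∸ (relief zero + relief (suc zero))
  where
  relief : Fin 2 → ℕ
  relief r = if (entry r c ≡ᵇ 0) ∧ (entry r p ≡ᵇ 2) then 1 else 0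

everyDigit : (ℕ → Bool) → Bool
everyDigit Q = Q 0 ∧ Q 1 ∧ Q 2

everyDigit-sound : ∀ Q → T (everyDigit Q) → ∀ x → T (x ≤ᵇ 2) → T (Q x)
everyDigit-sound Q h 0 _ = proj₁ (T-∧-split {Q 0} h)
everyDigit-sound Q h 1 _ = proj₁ (T-∧-split {Q 1} (proj₂ (T-∧-split {Q 0} h)))
everyDigit-sound Q h 2 _ = proj₂ (T-∧-split {Q 1} (proj₂ (T-∧-split {Q 0} h)))

everyColumn : (Column → Bool) → Bool
everyColumn Q = everyDigit λ a → everyDigit λ b → Q (a , b)

everyColumn-sound : ∀ Q → T (everyColumn Q) → ∀ c → T (bounded c) → T (Q c)
everyColumn-sound Q h (a , b) hc =
  everyDigit-sound (λ b → Q (a , b)) (everyDigit-sound (λ a → everyDigit λ b → Q (a , b)) h a a≤2) b b≤2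
  where
  a≤2 = proj₁ (T-∧-split {a ≤ᵇ 2} hc)
  b≤2 = proj₂ (T-∧-split {a ≤ᵇ 2} hc)

-- The two local inequalities are checked by evaluation on all columns with entries in {0, 1, 2}.
potential-last : ∀ p c → T (bounded p) → T (romanAt everySlot 0 p c emptyColumn) →
  potential p c ≤ columnWeight c
potential-last p c bp h =
  ≤ᵇ⇒≤ _ _ (T-⇒ (everyColumn-sound (Q p) (everyColumn-sound (λ p → everyColumn (Q p)) tt p bp) c bc) h)
  where
  bc = romanAt-bounded everySlot 0 p c emptyColumn h
  Q : Column → Column → Bool
  Q p c = not (romanAt everySlot 0 p c emptyColumn) ∨ (potential p c ≤ᵇ columnWeight c)

potential-step : ∀ p c c' → T (bounded p) → T (bounded c') → T (romanAt everySlot 0 p c c') →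
  potential p c + 1 ≤ columnWeight c + potential c c'
potential-step p c c' bp bc' h =
  ≤ᵇ⇒≤ _ _ (T-⇒ (everyColumn-sound (Q p c) (everyColumn-sound (λ c → everyColumn (Q p c))
    (everyColumn-sound (λ p → everyColumn λ c → everyColumn (Q p c)) tt p bp) c bc) c' bc') h)
  where
  bc = romanAt-bounded everySlot 0 p c c' h
  Q : Column → Column → Column → Bool
  Q p c c' = not (romanAt everySlot 0 p c c') ∨ (potential p c + 1 ≤ᵇ columnWeight c + potential c c')

potential-bound : ∀ j p c cs → T (bounded p) → RomanColumns everySlot j p (c ∷ cs) →
  potential p c + length cs ≤ totalWeight (c ∷ cs)
potential-bound j p c [] bp (h , _) = begin
  potential p c + 0       ≡⟨ +-identityʳ _ ⟩
  potential p c           ≤⟨ potential-last p c bp h ⟩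
  columnWeight c          ≡⟨ +-identityʳ _ ⟨
  columnWeight c + 0      ∎
  where open ≤-Reasoning
potential-bound j p c (c' ∷ cs) bp (h , hs@(h' , _)) = begin
  potential p c + suc (length cs)              ≡⟨ +-assoc (potential p c) 1 _ ⟨
  potential p c + 1 + length cs                ≤⟨ +-monoˡ-≤ _ (potential-step p c c' bp bc' h) ⟩
  columnWeight c + potential c c' + length cs  ≡⟨ +-assoc (columnWeight c) _ _ ⟩
  columnWeight c + (potential c c' + length cs) ≤⟨ +-monoʳ-≤ (columnWeight c) (potential-bound (suc j) c c' cs bc hs) ⟩
  totalWeight (c ∷ c' ∷ cs)                    ∎
  where
  open ≤-Reasoning
  bc = romanAt-bounded everySlot j p c c' h
  bc' = romanAt-bounded everySlot (suc j) c c' (columnAt cs 0) h'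

romanColumns-weight : ∀ j c cs → RomanColumns everySlot j emptyColumn (c ∷ cs) →
  2 + length cs ≤ totalWeight (c ∷ cs)
romanColumns-weight j c cs h@(hc , _) =
  ≤-trans (+-monoˡ-≤ (length cs) potential-empty) (potential-bound j emptyColumn c cs tt h)
  where
  potential-empty : 2 ≤ potential emptyColumn c
  potential-empty = ≤ᵇ⇒≤ 2 _ (everyColumn-sound (λ c → 2 ≤ᵇ potential emptyColumn c) tt c
                               (romanAt-bounded everySlot j emptyColumn c (columnAt cs 0) hc))

Vertex : ℕ → Set
Vertex n = Fin 2 × Fin n

data Neighbour {n : ℕ} : Vertex n → Vertex n → Set where
  down  : ∀ i → Neighbour (zero , i) (suc zero , i)
  up    : ∀ i → Neighbour (suc zero , i) (zero , i)
  left  : ∀ r {i k} → suc (toℕ k) ≡ toℕ i → Neighbour (r , i) (r , k)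
  right : ∀ r {i k} → suc (toℕ i) ≡ toℕ k → Neighbour (r , i) (r , k)

across : ∀ {n} r (i : Fin n) → Neighbour (r , i) (otherRow r , i)
across zero       i = down i
across (suc zero) i = up i

2+n≢n : ∀ (n : ℕ) → suc (suc n) ≢ n
2+n≢n (suc n) eq = 2+n≢n n (suc-injective eq)

flip : ∀ {n} {u v : Vertex n} → Neighbour u v → Neighbour v u
flip (down i)    = up i
flip (up i)      = down i
flip (left r s)  = right r s
flip (right r s) = left r s

Neighbour-irrefl : ∀ {n} {u v : Vertex n} → Neighbour u v → u ≢ v
Neighbour-irrefl (down i)    ()
Neighbour-irrefl (up i)      ()
Neighbour-irrefl (left r s)  refl = 1+n≢n s
Neighbour-irrefl (right r s) refl = 1+n≢n s

slot : ∀ {n} {u v : Vertex n} → Neighbour u v → Slot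
slot (down i)            = rung (toℕ i)
slot (up i)              = rung (toℕ i)
slot (left r {i} _)      = rail r (toℕ i)
slot (right r {k = k} _) = rail r (toℕ k)

slot-across : ∀ {n} r (i : Fin n) → slot (across r i) ≡ rung (toℕ i)
slot-across zero       i = refl
slot-across (suc zero) i = refl

slot-flip : ∀ {n} {u v : Vertex n} (nb : Neighbour u v) → slot (flip nb) ≡ slot nb
slot-flip (down i)    = refl
slot-flip (up i)      = refl
slot-flip (left r s)  = refl
slot-flip (right r s) = refl

slot-unique : ∀ {n} {u v : Vertex n} (nb nb′ : Neighbour u v) → slot nb ≡ slot nb′
slot-unique (down i)    (down .i)   = refl
slot-unique (up i)      (up .i)     = refl
slot-unique (left r s)  (left .r _) = refl
slot-unique (left r s)  (right .r s′) = contradiction (trans (cong suc s) s′) (2+n≢n _)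
slot-unique (right r s) (left .r s′) = contradiction (trans (cong suc s′) s) (2+n≢n _)
slot-unique (right r s) (right .r _) = refl

module _ {n : ℕ} where

  private
    G = P2×Pn n

    pathAdj-sound : ∀ (i k : Fin n) → pathAdj n i k ≡ true → suc (toℕ i) ≡ toℕ k ⊎ suc (toℕ k) ≡ toℕ i
    pathAdj-sound i k h with ∨-true ⌊ suc (toℕ i) ≟ toℕ k ⌋ h
    ... | inj₁ h′ = inj₁ (⌊⌋-sound (suc (toℕ i) ≟ toℕ k) h′)
    ... | inj₂ h′ = inj₂ (⌊⌋-sound (suc (toℕ k) ≟ toℕ i) h′)

    sameRow-adj : ∀ r (i k : Fin n) → pathAdj n i k ≡ true → adj G (r , i) (r , k) ≡ true
    sameRow-adj r i k h =
      cong (_∨ (⌊ i FinP.≟ k ⌋ ∧ pathAdj 2 r r)) (trans (cong (_∧ pathAdj n i k) (⌊⌋-true (r FinP.≟ r) refl)) h)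

    sameColumn-adj : ∀ (i : Fin n) → ⌊ i FinP.≟ i ⌋ ∧ true ≡ true
    sameColumn-adj i = trans (∧-identityʳ _) (⌊⌋-true (i FinP.≟ i) refl)

    sameRow : ∀ r (i k : Fin n) → pathAdj n i k ∨ (⌊ i FinP.≟ k ⌋ ∧ false) ≡ true → Neighbour (r , i) (r , k)
    sameRow r i k h with ∨-true (pathAdj n i k) h
    ... | inj₂ h′ = contradiction (trans (sym (∧-zeroʳ ⌊ i FinP.≟ k ⌋)) h′) λ ()
    ... | inj₁ h′ with pathAdj-sound i k h′
    ...   | inj₁ s = right r s
    ...   | inj₂ s = left r s

    sameColumn : ∀ (i k : Fin n) → ⌊ i FinP.≟ k ⌋ ∧ true ≡ true → i ≡ k
    sameColumn i k h = ⌊⌋-sound (i FinP.≟ k) (trans (sym (∧-identityʳ _)) h)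

  Neighbour⇒adj : ∀ {u v} → Neighbour u v → adj G u v ≡ true
  Neighbour⇒adj (down i) = sameColumn-adj i
  Neighbour⇒adj (up i)   = sameColumn-adj i
  Neighbour⇒adj (left r {i} {k} s) = sameRow-adj r i k
    (trans (cong (⌊ suc (toℕ i) ≟ toℕ k ⌋ ∨_) (⌊⌋-true (suc (toℕ k) ≟ toℕ i) s)) (∨-zeroʳ ⌊ suc (toℕ i) ≟ toℕ k ⌋))
  Neighbour⇒adj (right r {i} {k} s) = sameRow-adj r i k
    (cong (_∨ ⌊ suc (toℕ k) ≟ toℕ i ⌋) (⌊⌋-true (suc (toℕ i) ≟ toℕ k) s))

  adj⇒Neighbour : ∀ u v → adj G u v ≡ true → Neighbour u v
  adj⇒Neighbour (zero , i)     (zero , k)     h = sameRow zero i k h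
  adj⇒Neighbour (suc zero , i) (suc zero , k) h = sameRow (suc zero) i k h
  adj⇒Neighbour (zero , i)     (suc zero , k) h rewrite sameColumn i k h = down k
  adj⇒Neighbour (suc zero , i) (zero , k)     h rewrite sameColumn i k h = up k

deleteEdges-adj⁺ : ∀ {n} (E : EdgeSet (P2×Pn n)) {u v} → Neighbour u v → mem E u v ≡ false →
  adj (deleteEdges (P2×Pn n) E) u v ≡ true
deleteEdges-adj⁺ E nb m rewrite Neighbour⇒adj nb | m = refl

deleteEdges-adj⁻ : ∀ {n} (E : EdgeSet (P2×Pn n)) u v → adj (deleteEdges (P2×Pn n) E) u v ≡ true →
  adj (P2×Pn n) u v ≡ true × mem E u v ≡ false
deleteEdges-adj⁻ {n} E u v h with adj (P2×Pn n) u v | mem E u v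
... | true | false = refl , refl

Avoids : ∀ {n} → EdgeSet (P2×Pn n) → Layout → Set
Avoids E L = ∀ {u v} (nb : Neighbour u v) → T (L (slot nb)) → mem E u v ≡ false

sum-tabulate-+ : ∀ {n} (g h : Fin n → ℕ) → sum (tabulate g) + sum (tabulate h) ≡ sum (tabulate λ i → g i + h i)
sum-tabulate-+ {zero}  g h = refl
sum-tabulate-+ {suc n} g h =
  trans (+-interchange (g zero) _ (h zero) _) (cong (g zero + h zero +_) (sum-tabulate-+ (g ∘ suc) (h ∘ suc)))

columnAt-tabulate : ∀ {n} (g : Fin n → Column) i → columnAt (tabulate g) (toℕ i) ≡ g i
columnAt-tabulate g zero    = refl
columnAt-tabulate g (suc i) = columnAt-tabulate (g ∘ suc) i

tabulate-columnAt : ∀ cs → tabulate (λ (i : Fin (length cs)) → columnAt cs (toℕ i)) ≡ cs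
tabulate-columnAt []       = refl
tabulate-columnAt (c ∷ cs) = cong (c ∷_) (tabulate-columnAt cs)

columnAt-beyond : ∀ cs k → length cs ≤ k → columnAt cs k ≡ emptyColumn
columnAt-beyond []       k       _         = refl
columnAt-beyond (c ∷ cs) (suc k) (s≤s le) = columnAt-beyond cs k le

columnAt-previous : ∀ {n} cs r (i : Fin n) → entry r (columnAt (emptyColumn ∷ cs) (toℕ i)) ≡ 2 →
  Σ (Fin n) λ k → suc (toℕ k) ≡ toℕ i × entry r (columnAt cs (toℕ k)) ≡ 2
columnAt-previous cs r zero    e = contradiction e (emptyColumn-entry≢2 r)
columnAt-previous cs r (suc i) e =
  inject₁ i , cong suc (toℕ-inject₁ i) , subst (λ x → entry r (columnAt cs x) ≡ 2) (sym (toℕ-inject₁ i)) e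

columnAt-following : ∀ {n} cs → length cs ≡ n → ∀ r (i : Fin n) → entry r (columnAt cs (suc (toℕ i))) ≡ 2 →
  Σ (Fin n) λ k → suc (toℕ i) ≡ toℕ k × entry r (columnAt cs (toℕ k)) ≡ 2
columnAt-following {n} cs len r i e with suc (toℕ i) <? n
... | no  i+1≮n = contradiction (subst (λ c → entry r c ≡ 2) (columnAt-beyond cs _ beyond) e) (emptyColumn-entry≢2 r)
  where beyond = subst (_≤ suc (toℕ i)) (sym len) (≮⇒≥ i+1≮n)
... | yes i+1<n =
  fromℕ< i+1<n , sym (toℕ-fromℕ< i+1<n) , subst (λ x → entry r (columnAt cs x) ≡ 2) (sym (toℕ-fromℕ< i+1<n)) e

module _ {n : ℕ} where

  column : (Vertex n → ℕ) → Fin n → Column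
  column f i = f (zero , i) , f (suc zero , i)

  columns : (Vertex n → ℕ) → List Column
  columns f = tabulate (column f)

  fromColumns : List Column → Vertex n → ℕ
  fromColumns cs (r , i) = entry r (columnAt cs (toℕ i))

  entry-column : ∀ (f : Vertex n → ℕ) r i → entry r (column f i) ≡ f (r , i)
  entry-column f zero       i = refl
  entry-column f (suc zero) i = refl

  entry-columnAt-columns : ∀ (f : Vertex n → ℕ) r i → entry r (columnAt (columns f) (toℕ i)) ≡ f (r , i)
  entry-columnAt-columns f r i = trans (cong (entry r) (columnAt-tabulate (column f) i)) (entry-column f r i)

  weight-columns : ∀ f → weight (P2×Pn n) f ≡ totalWeight (columns f)
  weight-columns f = begin
    sum (map f (row zero ++ row (suc zero) ++ []))
      ≡⟨ cong sum (map-++ f (row zero) _) ⟩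
    sum (map f (row zero) ++ map f (row (suc zero) ++ []))
      ≡⟨ sum-++ (map f (row zero)) _ ⟩
    sum (map f (row zero)) + sum (map f (row (suc zero) ++ []))
      ≡⟨ cong₂ _+_ (rowSum zero) (trans (cong (sum ∘ map f) (++-identityʳ (row (suc zero)))) (rowSum (suc zero))) ⟩
    sum (tabulate λ i → f (zero , i)) + sum (tabulate λ i → f (suc zero , i))
      ≡⟨ sum-tabulate-+ (λ i → f (zero , i)) (λ i → f (suc zero , i)) ⟩
    sum (tabulate (columnWeight ∘ column f))
      ≡⟨ cong sum (map-tabulate (column f) columnWeight) ⟨
    totalWeight (columns f) ∎
    where
    open ≡-Reasoning
    row : Fin 2 → List (Vertex n)
    row r = map (r ,_) (allFin n)
    rowSum : ∀ r → sum (map f (row r)) ≡ sum (tabulate λ i → f (r , i))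
    rowSum r = cong sum (trans (cong (map f) (map-tabulate id (r ,_))) (map-tabulate (r ,_) f))

weight-fromColumns : ∀ {n} cs → length cs ≡ n → weight (P2×Pn n) (fromColumns cs) ≡ totalWeight cs
weight-fromColumns cs refl = trans (weight-columns {length cs} (fromColumns cs)) (cong totalWeight (tabulate-columnAt cs))

module _ {n : ℕ} (f : Vertex n → ℕ) where

  private
    cs = columns f

    CoverOptions : Vertex n → Set
    CoverOptions (r , i) =
      entry (otherRow r) (column f i) ≡ 2
      ⊎ entry r (columnAt (emptyColumn ∷ cs) (toℕ i)) ≡ 2
      ⊎ entry r (columnAt cs (suc (toℕ i))) ≡ 2

    neighbour-cover : ∀ {v u} → Neighbour v u → f u ≡ 2 → CoverOptions v
    neighbour-cover (down i) f₂ = inj₁ f₂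
    neighbour-cover (up i)   f₂ = inj₁ f₂
    neighbour-cover (left r {i} {k} s) f₂ =
      inj₂ (inj₁ (subst (λ x → entry r (columnAt (emptyColumn ∷ cs) x) ≡ 2) s (trans (entry-columnAt-columns f r k) f₂)))
    neighbour-cover (right r {i} {k} s) f₂ =
      inj₂ (inj₂ (subst (λ x → entry r (columnAt cs x) ≡ 2) (sym s) (trans (entry-columnAt-columns f r k) f₂)))

  rdf⇒romanColumns : IsRDF (P2×Pn n) f → RomanColumns everySlot 0 emptyColumn cs
  rdf⇒romanColumns (bounds , dominated) = romanColumns-from-at everySlot 0 emptyColumn cs λ k k<len →
    let k<n = subst (k <_) (length-tabulate (column f)) k<len
    in subst (λ x → T (romanAt everySlot x (columnAt (emptyColumn ∷ cs) x) (columnAt cs x) (columnAt cs (suc x))))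
             (toℕ-fromℕ< k<n) (romanAt-column (fromℕ< k<n))
    where
    coverRow : ∀ r i → T (covered true true true r (columnAt (emptyColumn ∷ cs) (toℕ i))
                                  (column f i) (columnAt cs (suc (toℕ i))))
    coverRow r i = covered-intro r _ _ _ λ c₀ →
      let (u , a , f₂) = dominated (r , i) (trans (sym (entry-column f r i)) c₀)
      in neighbour-cover (adj⇒Neighbour (r , i) u a) f₂
    romanAt-column : ∀ i → T (romanAt everySlot (toℕ i) (columnAt (emptyColumn ∷ cs) (toℕ i))
                                      (columnAt cs (toℕ i)) (columnAt cs (suc (toℕ i))))
    romanAt-column i rewrite columnAt-tabulate (column f) i =
      T-∧-intro (bounded-intro (column f i) (bounds (zero , i)) (bounds (suc zero , i)))
                (T-∧-intro (coverRow zero i) (coverRow (suc zero) i))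

rdf⇒weight≥ : ∀ n f → IsRDF (P2×Pn (suc n)) f → 2 + n ≤ weight (P2×Pn (suc n)) f
rdf⇒weight≥ n f rdf =
  subst₂ _≤_ (cong (2 +_) (length-tabulate (column f ∘ suc))) (sym (weight-columns f))
         (romanColumns-weight 0 (column f zero) (tabulate (column f ∘ suc)) (rdf⇒romanColumns f rdf))

module _ {n : ℕ} (E : EdgeSet (P2×Pn n)) where

  romanColumns⇒rdf : ∀ L cs → length cs ≡ n → RomanColumns L 0 emptyColumn cs → Avoids E L →
    IsRDF (deleteEdges (P2×Pn n) E) (fromColumns cs)
  romanColumns⇒rdf L cs len roman avoids = bounds , dominated
    where
    f = fromColumns cs
    previous current following : Fin n → Column
    previous i = columnAt (emptyColumn ∷ cs) (toℕ i)
    current i = columnAt cs (toℕ i)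
    following i = columnAt cs (suc (toℕ i))
    roman-at : ∀ i → T (romanAt L (toℕ i) (previous i) (current i) (following i))
    roman-at i = romanColumns-at L 0 emptyColumn cs roman (toℕ i) (subst (toℕ i <_) (sym len) (toℕ<n i))
    bounds : ∀ v → f v ≤ 2
    bounds (r , i) =
      bounded-elim (current i) r (romanAt-bounded L (toℕ i) (previous i) (current i) (following i) (roman-at i))
    Witness : Vertex n → Set
    Witness v = Σ (Vertex n) λ u → adj (deleteEdges (P2×Pn n) E) v u ≡ true × f u ≡ 2
    witness : ∀ {v u} (nb : Neighbour v u) → T (L (slot nb)) → f u ≡ 2 → Witness v
    witness {u = u} nb kept f₂ = u , deleteEdges-adj⁺ E nb (avoids nb kept) , f₂
    rowCover : ∀ r i → T (covered (L (rung (toℕ i))) (L (rail r (toℕ i))) (L (rail r (suc (toℕ i)))) r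
                                  (previous i) (current i) (following i))
    rowCover r i = romanAt-covered L (toℕ i) (previous i) (current i) (following i) (roman-at i) r
    dominated : ∀ v → f v ≡ 0 → Witness v
    dominated (r , i) f₀
      with covered-elim (L (rung (toℕ i))) (L (rail r (toℕ i))) (L (rail r (suc (toℕ i)))) r
                        (previous i) (current i) (following i) (rowCover r i) f₀
    ... | inj₁ (kept , f₂) = witness (across r i) (subst (T ∘ L) (sym (slot-across r i)) kept) f₂
    ... | inj₂ (inj₁ (kept , f₂)) =
      let (k , k+1≡i , f₂′) = columnAt-previous cs r i f₂ in witness (left r k+1≡i) kept f₂′
    ... | inj₂ (inj₂ (kept , f₂)) =
      let (k , i+1≡k , f₂′) = columnAt-following cs len r i f₂
      in witness (right r i+1≡k) (subst (λ x → T (L (rail r x))) i+1≡k kept) f₂′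

-- Periodic Roman dominating functions

data Phase : Set where
  φ₀ φ₁ φ₂ φ₃ : Phase

tick : Phase → Phase
tick φ₀ = φ₁
tick φ₁ = φ₂
tick φ₂ = φ₃
tick φ₃ = φ₀

phaseOf : ℕ → Phase
phaseOf zero    = φ₀
phaseOf (suc j) = tick (phaseOf j)

romanPhase : (Phase → Bool) → (Fin 2 → Phase → Bool) → Phase → Column → Column → Column → Bool
romanPhase rk lk x = romanColumn (rk x) (λ r → lk r x) (λ r → lk r (tick x))

-- A column sequence produced by a finite automaton: from state s the sequence continues with
-- middle s unless it ends there, in which case its last column is final s.  The rung and rail
-- flags (rk, lk) record which edges the Roman condition is allowed to use in each phase.
record Pattern (rk : Phase → Bool) (lk : Fin 2 → Phase → Bool) : Set₁ where
  field
    State              : Set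
    start              : State
    next               : State → State
    phase              : State → Phase
    before             : State → Column
    middle final       : State → Column
    excess             : State → ℕ
    start-before       : before start ≡ emptyColumn
    start-phase        : phase start ≡ φ₀
    next-before        : ∀ s → before (next s) ≡ middle s
    next-phase         : ∀ s → phase (next s) ≡ tick (phase s)
    final-roman        : ∀ s → T (romanPhase rk lk (phase s) (before s) (final s) emptyColumn)
    middle-roman       : ∀ s → T (romanPhase rk lk (phase s) (before s) (middle s) (middle (next s)))
    middle-final-roman : ∀ s → T (romanPhase rk lk (phase s) (before s) (middle s) (final (next s)))
    final-weight       : ∀ s → columnWeight (final s) ≡ suc (excess s)
    middle-weight      : ∀ s → columnWeight (middle s) + excess (next s) ≡ suc (excess s)

phaseLayout : (Phase → Bool) → (Fin 2 → Phase → Bool) → Layout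
phaseLayout rk lk (rung j)   = rk (phaseOf j)
phaseLayout rk lk (rail r j) = lk r (phaseOf j)

module _ {rk lk} (P : Pattern rk lk) where
  open Pattern P

  generate : State → ℕ → List Column
  generate s zero          = []
  generate s (suc zero)    = final s ∷ []
  generate s (suc (suc m)) = middle s ∷ generate (next s) (suc m)

  generate-length : ∀ s m → length (generate s m) ≡ m
  generate-length s zero          = refl
  generate-length s (suc zero)    = refl
  generate-length s (suc (suc m)) = cong suc (generate-length (next s) (suc m))

  generate-weight : ∀ s m → totalWeight (generate s (suc m)) ≡ suc m + excess s
  generate-weight s zero    = trans (+-identityʳ _) (final-weight s)
  generate-weight s (suc m) = begin
    columnWeight (middle s) + totalWeight (generate (next s) (suc m))
      ≡⟨ cong (columnWeight (middle s) +_) (generate-weight (next s) m) ⟩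
    columnWeight (middle s) + (suc m + excess (next s))
      ≡⟨ x∙yz≈y∙xz (columnWeight (middle s)) (suc m) (excess (next s)) ⟩
    suc m + (columnWeight (middle s) + excess (next s))
      ≡⟨ cong (suc m +_) (middle-weight s) ⟩
    suc m + suc (excess s)
      ≡⟨ +-suc (suc m) (excess s) ⟩
    suc (suc m) + excess s ∎
    where open ≡-Reasoning

  generate-roman : ∀ s m j → phaseOf j ≡ phase s →
    RomanColumns (phaseLayout rk lk) j (before s) (generate s (suc m))
  generate-roman s zero j φ =
    subst (λ x → T (romanPhase rk lk x (before s) (final s) emptyColumn)) (sym φ) (final-roman s) , tt
  generate-roman s (suc m) j φ =
    roman-head m ,
    subst (λ p → RomanColumns (phaseLayout rk lk) (suc j) p (generate (next s) (suc m))) (next-before s)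
          (generate-roman (next s) m (suc j) (trans (cong tick φ) (sym (next-phase s))))
    where
    roman-head : ∀ m → T (romanPhase rk lk (phaseOf j) (before s) (middle s) (columnAt (generate (next s) (suc m)) 0))
    roman-head zero    =
      subst (λ x → T (romanPhase rk lk x (before s) (middle s) (final (next s)))) (sym φ) (middle-final-roman s)
    roman-head (suc m) =
      subst (λ x → T (romanPhase rk lk x (before s) (middle s) (middle (next s)))) (sym φ) (middle-roman s)

  pattern-rdf : ∀ m (E : EdgeSet (P2×Pn (suc m))) → Avoids E (phaseLayout rk lk) →
    IsRDF (deleteEdges (P2×Pn (suc m)) E) (fromColumns (generate start (suc m)))
  pattern-rdf m E avoids =
    romanColumns⇒rdf E (phaseLayout rk lk) (generate start (suc m)) (generate-length start (suc m))
      (subst (λ p → RomanColumns (phaseLayout rk lk) 0 p (generate start (suc m))) start-before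
             (generate-roman start m 0 (sym start-phase)))
      avoids

  pattern-weight : ∀ m → weight (P2×Pn (suc m)) (fromColumns (generate start (suc m))) ≡ excess start + suc m
  pattern-weight m = begin
    weight (P2×Pn (suc m)) (fromColumns (generate start (suc m)))
      ≡⟨ weight-fromColumns (generate start (suc m)) (generate-length start (suc m)) ⟩
    totalWeight (generate start (suc m))
      ≡⟨ generate-weight start m ⟩
    suc m + excess start
      ≡⟨ +-comm (suc m) (excess start) ⟩
    excess start + suc m ∎
    where open ≡-Reasoning

romanColumn-swap : ∀ a lk rtk p c c' →
  romanColumn a (lk ∘ otherRow) (rtk ∘ otherRow) (swap p) (swap c) (swap c') ≡ romanColumn a lk rtk p c c'
romanColumn-swap a lk rtk p c c' =
  cong₂ _∧_ (∧-comm (proj₂ c ≤ᵇ 2) (proj₁ c ≤ᵇ 2))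
            (∧-comm (covered a (lk (suc zero)) (rtk (suc zero)) (suc zero) p c c')
                    (covered a (lk zero) (rtk zero) zero p c c'))

mirror : ∀ {rk lk} → Pattern rk lk → Pattern rk (λ r → lk (otherRow r))
mirror {rk} {lk} P = record
  { State              = State
  ; start              = start
  ; next               = next
  ; phase              = phase
  ; before             = swap ∘ before
  ; middle             = swap ∘ middle
  ; final              = swap ∘ final
  ; excess             = excess
  ; start-before       = cong swap start-before
  ; start-phase        = start-phase
  ; next-before        = cong swap ∘ next-before
  ; next-phase         = next-phase
  ; final-roman        = λ s → swapped (phase s) (before s) (final s) emptyColumn (final-roman s)
  ; middle-roman       = λ s → swapped (phase s) (before s) (middle s) (middle (next s)) (middle-roman s)
  ; middle-final-roman = λ s → swapped (phase s) (before s) (middle s) (final (next s)) (middle-final-roman s)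
  ; final-weight       = λ s → trans (+-comm (proj₂ (final s)) _) (final-weight s)
  ; middle-weight      = λ s → trans (cong (_+ excess (next s)) (+-comm (proj₂ (middle s)) _)) (middle-weight s)
  }
  where
  open Pattern P
  swapped : ∀ x p c c' → T (romanPhase rk lk x p c c') →
    T (romanPhase rk (λ r → lk (otherRow r)) x (swap p) (swap c) (swap c'))
  swapped x p c c' = subst T (sym (romanColumn-swap (rk x) (λ r → lk r x) (λ r → lk r (tick x)) p c c'))

oddPhase : Phase → Bool
oddPhase φ₁ = true
oddPhase φ₃ = true
oddPhase _  = false

zigzagRails : Fin 2 → Phase → Bool
zigzagRails zero       φ₁ = true
zigzagRails zero       φ₂ = true
zigzagRails (suc zero) φ₃ = true
zigzagRails (suc zero) φ₀ = true
zigzagRails _          _  = false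

data ZigzagState : Set where
  lead₀ lead₁ loop₀ loop₁ loop₂ loop₃ : ZigzagState

-- The columns read 01 20 00 02 00 20 00 02 … (top entry first).
zigzag : Pattern oddPhase zigzagRails
zigzag = record
  { State              = ZigzagState
  ; start              = lead₀
  ; next               = λ { lead₀ → lead₁ ; lead₁ → loop₀ ; loop₀ → loop₁ ; loop₁ → loop₂ ; loop₂ → loop₃ ; loop₃ → loop₀ }
  ; phase              = λ { lead₀ → φ₀ ; lead₁ → φ₁ ; loop₀ → φ₂ ; loop₁ → φ₃ ; loop₂ → φ₀ ; loop₃ → φ₁ }
  ; before             = λ { lead₀ → 0 , 0 ; lead₁ → 0 , 1 ; loop₀ → 2 , 0 ; loop₁ → 0 , 0 ; loop₂ → 0 , 2 ; loop₃ → 0 , 0 }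
  ; middle             = λ { lead₀ → 0 , 1 ; lead₁ → 2 , 0 ; loop₀ → 0 , 0 ; loop₁ → 0 , 2 ; loop₂ → 0 , 0 ; loop₃ → 2 , 0 }
  ; final              = λ { lead₀ → 1 , 1 ; lead₁ → 2 , 0 ; loop₀ → 0 , 1 ; loop₁ → 0 , 2 ; loop₂ → 1 , 0 ; loop₃ → 2 , 0 }
  ; excess             = λ { lead₀ → 1 ; lead₁ → 1 ; loop₀ → 0 ; loop₁ → 1 ; loop₂ → 0 ; loop₃ → 1 }
  ; start-before       = refl
  ; start-phase        = refl
  ; next-before        = λ { lead₀ → refl ; lead₁ → refl ; loop₀ → refl ; loop₁ → refl ; loop₂ → refl ; loop₃ → refl }
  ; next-phase         = λ { lead₀ → refl ; lead₁ → refl ; loop₀ → refl ; loop₁ → refl ; loop₂ → refl ; loop₃ → refl }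
  ; final-roman        = λ { lead₀ → tt ; lead₁ → tt ; loop₀ → tt ; loop₁ → tt ; loop₂ → tt ; loop₃ → tt }
  ; middle-roman       = λ { lead₀ → tt ; lead₁ → tt ; loop₀ → tt ; loop₁ → tt ; loop₂ → tt ; loop₃ → tt }
  ; middle-final-roman = λ { lead₀ → tt ; lead₁ → tt ; loop₀ → tt ; loop₁ → tt ; loop₂ → tt ; loop₃ → tt }
  ; final-weight       = λ { lead₀ → refl ; lead₁ → refl ; loop₀ → refl ; loop₁ → refl ; loop₂ → refl ; loop₃ → refl }
  ; middle-weight      = λ { lead₀ → refl ; lead₁ → refl ; loop₀ → refl ; loop₁ → refl ; loop₂ → refl ; loop₃ → refl }
  }

data LoopState : Set where
  loop₀ loop₁ loop₂ loop₃ : LoopState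

-- The columns read 20 00 02 00 20 00 02 … (top entry first).
evenZigzag : Pattern (not ∘ oddPhase) (λ _ _ → true)
evenZigzag = record
  { State              = LoopState
  ; start              = loop₀
  ; next               = λ { loop₀ → loop₁ ; loop₁ → loop₂ ; loop₂ → loop₃ ; loop₃ → loop₀ }
  ; phase              = λ { loop₀ → φ₀ ; loop₁ → φ₁ ; loop₂ → φ₂ ; loop₃ → φ₃ }
  ; before             = λ { loop₀ → 0 , 0 ; loop₁ → 2 , 0 ; loop₂ → 0 , 0 ; loop₃ → 0 , 2 }
  ; middle             = λ { loop₀ → 2 , 0 ; loop₁ → 0 , 0 ; loop₂ → 0 , 2 ; loop₃ → 0 , 0 }
  ; final              = λ { loop₀ → 2 , 0 ; loop₁ → 0 , 1 ; loop₂ → 0 , 2 ; loop₃ → 1 , 0 }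
  ; excess             = λ { loop₀ → 1 ; loop₁ → 0 ; loop₂ → 1 ; loop₃ → 0 }
  ; start-before       = refl
  ; start-phase        = refl
  ; next-before        = λ { loop₀ → refl ; loop₁ → refl ; loop₂ → refl ; loop₃ → refl }
  ; next-phase         = λ { loop₀ → refl ; loop₁ → refl ; loop₂ → refl ; loop₃ → refl }
  ; final-roman        = λ { loop₀ → tt ; loop₁ → tt ; loop₂ → tt ; loop₃ → tt }
  ; middle-roman       = λ { loop₀ → tt ; loop₁ → tt ; loop₂ → tt ; loop₃ → tt }
  ; middle-final-roman = λ { loop₀ → tt ; loop₁ → tt ; loop₂ → tt ; loop₃ → tt }
  ; final-weight       = λ { loop₀ → refl ; loop₁ → refl ; loop₂ → refl ; loop₃ → refl }
  ; middle-weight      = λ { loop₀ → refl ; loop₁ → refl ; loop₂ → refl ; loop₃ → refl }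
  }

zigzagLayout mirrorLayout evenLayout : Layout
zigzagLayout = phaseLayout oddPhase zigzagRails
mirrorLayout = phaseLayout oddPhase (λ r → zigzagRails (otherRow r))
evenLayout   = phaseLayout (not ∘ oddPhase) (λ _ _ → true)

slot-dropped : ∀ s → zigzagLayout s ≡ false ⊎ mirrorLayout s ≡ false ⊎ evenLayout s ≡ false
slot-dropped (rung j) with oddPhase (phaseOf j)
... | true  = inj₂ (inj₂ refl)
... | false = inj₁ refl
slot-dropped (rail r j) = rail-dropped r (phaseOf j)
  where
  rail-dropped : ∀ r x → zigzagRails r x ≡ false ⊎ zigzagRails (otherRow r) x ≡ false ⊎ true ≡ false
  rail-dropped zero       φ₀ = inj₁ refl
  rail-dropped zero       φ₁ = inj₂ (inj₁ refl)
  rail-dropped zero       φ₂ = inj₂ (inj₁ refl)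
  rail-dropped zero       φ₃ = inj₁ refl
  rail-dropped (suc zero) φ₀ = inj₂ (inj₁ refl)
  rail-dropped (suc zero) φ₁ = inj₁ refl
  rail-dropped (suc zero) φ₂ = inj₁ refl
  rail-dropped (suc zero) φ₃ = inj₂ (inj₁ refl)

-- Edge sets with fewer than two edges

module _ {A : Set} where

  ∈-─ : ∀ {x y : A} {ys} (x∈ys : x ∈ ys) → y ∈ ys → x ≢ y → y ∈ (ys ─ x∈ys)
  ∈-─ (here refl)  (here refl)  x≢y = contradiction refl x≢y
  ∈-─ (here _)     (there y∈ys) _   = y∈ys
  ∈-─ (there _)    (here refl)  _   = here refl
  ∈-─ (there x∈ys) (there y∈ys) x≢y = there (∈-─ x∈ys y∈ys x≢y)

  unique⇒length≤ : ∀ {xs ys : List A} → Unique xs → (∀ {z} → z ∈ xs → z ∈ ys) → length xs ≤ length ys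
  unique⇒length≤ {[]}          _           _   = z≤n
  unique⇒length≤ {x ∷ xs} {ys} (x∉xs ∷ xs!) sub = begin
    suc (length xs)          ≤⟨ s≤s (unique⇒length≤ xs! λ z∈xs → ∈-─ x∈ys (sub (there z∈xs)) (All.lookup x∉xs z∈xs)) ⟩
    suc (length (ys ─ x∈ys)) ≡⟨ length-removeAt′ ys (index x∈ys) ⟨
    length ys                ∎
    where
    open ≤-Reasoning
    x∈ys = sub (here refl)

module _ {n : ℕ} (E : EdgeSet (P2×Pn n)) where

  private
    G = P2×Pn n

  edgePair? : ∀ (p : Vertex n × Vertex n) → Dec (mem E (proj₁ p) (proj₂ p) ≡ true)
  edgePair? p = mem E (proj₁ p) (proj₂ p) ≟B true

  edgePairs : List (Vertex n × Vertex n)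
  edgePairs = filter edgePair? (cartesianProduct (verts G) (verts G))

  ∈-edgePairs : ∀ {u v} → mem E u v ≡ true → (u , v) ∈ edgePairs
  ∈-edgePairs {a , i} {b , k} m = ∈-filter⁺ _ (∈-cartesianProduct⁺ (∈-cartesianProduct⁺ (∈-allFin a) (∈-allFin i))
                                                                    (∈-cartesianProduct⁺ (∈-allFin b) (∈-allFin k))) m

  edgePairs-mem : ∀ {u v} → (u , v) ∈ edgePairs → mem E u v ≡ true
  edgePairs-mem p = proj₂ (∈-filter⁻ edgePair? {xs = cartesianProduct (verts G) (verts G)} p)

  mem⇒Neighbour : ∀ {u v} → mem E u v ≡ true → Neighbour u v
  mem⇒Neighbour {u} {v} m = adj⇒Neighbour u v (subset E u v m)

  -- An edge is counted as two ordered pairs, so two different edges give four.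
  two-edges⇒2≤card : ∀ {x y u v} → mem E x y ≡ true → mem E u v ≡ true →
    (u , v) ≢ (x , y) → (u , v) ≢ (y , x) → 2 ≤ card G E
  two-edges⇒2≤card {x} {y} {u} {v} mxy muv uv≢xy uv≢yx = /-monoˡ-≤ 2 (unique⇒length≤ distinct ⊆edgePairs)
    where
    x≢y = Neighbour-irrefl (mem⇒Neighbour mxy)
    u≢v = Neighbour-irrefl (mem⇒Neighbour muv)
    swap-≢ : ∀ {a b c d : Vertex n} → (a , b) ≢ (c , d) → (b , a) ≢ (d , c)
    swap-≢ ne refl = ne refl
    distinct : Unique ((x , y) ∷ (y , x) ∷ (u , v) ∷ (v , u) ∷ [])
    distinct = ((x≢y ∘ cong proj₁) ∷ (uv≢xy ∘ sym) ∷ (swap-≢ uv≢yx ∘ sym) ∷ [])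
             ∷ ((uv≢yx ∘ sym) ∷ (swap-≢ uv≢xy ∘ sym) ∷ [])
             ∷ ((u≢v ∘ cong proj₁) ∷ [])
             ∷ [] ∷ []
    ⊆edgePairs : ∀ {z} → z ∈ (x , y) ∷ (y , x) ∷ (u , v) ∷ (v , u) ∷ [] → z ∈ edgePairs
    ⊆edgePairs (here refl)                         = ∈-edgePairs mxy
    ⊆edgePairs (there (here refl))                 = ∈-edgePairs (trans (EdgeSet.sym E y x) mxy)
    ⊆edgePairs (there (there (here refl)))         = ∈-edgePairs muv
    ⊆edgePairs (there (there (there (here refl)))) = ∈-edgePairs (trans (EdgeSet.sym E v u) muv)

  avoids-when-dropped : ∀ L → (∀ {u v} (nb : Neighbour u v) → mem E u v ≡ true → L (slot nb) ≡ false) → Avoids E L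
  avoids-when-dropped L dropped {u} {v} nb kept with mem E u v in m
  ... | false = refl
  ... | true  = contradiction (subst T (dropped nb m) kept) λ ()

  single-edge-avoided : ∀ {x y} → ¬ (2 ≤ card G E) → (mxy : mem E x y ≡ true) →
    ∀ L → L (slot (mem⇒Neighbour mxy)) ≡ false → Avoids E L
  single-edge-avoided {x} {y} few mxy L dropped = avoids-when-dropped L only
    where
    nbxy = mem⇒Neighbour mxy
    _≟V_ : DecidableEquality (Vertex n × Vertex n)
    _≟V_ = ≡-dec (≡-dec FinP._≟_ FinP._≟_) (≡-dec FinP._≟_ FinP._≟_)
    only : ∀ {u v} (nb : Neighbour u v) → mem E u v ≡ true → L (slot nb) ≡ false
    only {u} {v} nb muv with (u , v) ≟V (x , y) | (u , v) ≟V (y , x)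
    ... | yes refl | _        = trans (cong L (slot-unique nb nbxy)) dropped
    ... | no _     | yes refl = trans (cong L (trans (slot-unique nb (flip nbxy)) (slot-flip nbxy))) dropped
    ... | no uv≢xy | no uv≢yx = contradiction (two-edges⇒2≤card mxy muv uv≢xy uv≢yx) few

  Avoided : Set
  Avoided = Avoids E zigzagLayout ⊎ Avoids E mirrorLayout ⊎ Avoids E evenLayout

  few-edges-avoided : ¬ (2 ≤ card G E) → Avoided
  few-edges-avoided few = from-pairs edgePairs refl
    where
    from-pairs : ∀ ps → edgePairs ≡ ps → Avoided
    from-pairs [] pairs = inj₁ (avoids-when-dropped zigzagLayout λ nb m →
      contradiction (subst ((_ , _) ∈_) pairs (∈-edgePairs m)) λ ())
    from-pairs ((x , y) ∷ _) pairs = edge-avoided (edgePairs-mem (subst ((x , y) ∈_) (sym pairs) (here refl)))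
      where
      edge-avoided : mem E x y ≡ true → Avoided
      edge-avoided mxy with slot-dropped (slot (mem⇒Neighbour mxy))
      ... | inj₁ dropped        = inj₁ (single-edge-avoided few mxy zigzagLayout dropped)
      ... | inj₂ (inj₁ dropped) = inj₂ (inj₁ (single-edge-avoided few mxy mirrorLayout dropped))
      ... | inj₂ (inj₂ dropped) = inj₂ (inj₂ (single-edge-avoided few mxy evenLayout dropped))

noEdges : ∀ {n} → EdgeSet (P2×Pn n)
noEdges = record { mem = λ _ _ → false ; sym = λ _ _ → refl ; subset = λ _ _ () }

rdf-noEdges : ∀ {n} f → IsRDF (deleteEdges (P2×Pn n) noEdges) f → IsRDF (P2×Pn n) f
rdf-noEdges f (bounds , dominated) = bounds , λ v f₀ →
  let (u , a , f₂) = dominated v f₀ in u , trans (sym (∧-identityʳ _)) a , f₂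

few-edges-rdf : ∀ m (E : EdgeSet (P2×Pn (suc m))) → ¬ (2 ≤ card (P2×Pn (suc m)) E) →
  Σ (Vertex (suc m) → ℕ) λ g → IsRDF (deleteEdges (P2×Pn (suc m)) E) g × weight (P2×Pn (suc m)) g ≡ 2 + m
few-edges-rdf m E few with few-edges-avoided E few
... | inj₁ avoids        = _ , pattern-rdf zigzag m E avoids , pattern-weight zigzag m
... | inj₂ (inj₁ avoids) = _ , pattern-rdf (mirror zigzag) m E avoids , pattern-weight (mirror zigzag) m
... | inj₂ (inj₂ avoids) = _ , pattern-rdf evenZigzag m E avoids , pattern-weight evenZigzag m

γR-P2×Pn : ∀ m → IsRomanDomNum (P2×Pn (suc m)) (2 + m)
γR-P2×Pn m = (_ , rdf-noEdges _ (pattern-rdf zigzag m noEdges λ _ _ → refl) , pattern-weight zigzag m) , rdf⇒weight≥ m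

raising⇒2≤card : ∀ m (E : EdgeSet (P2×Pn (suc m))) → RaisesRDN (P2×Pn (suc m)) E → 2 ≤ card (P2×Pn (suc m)) E
raising⇒2≤card m E (k , k′ , ((h , rdf-h , refl) , _) , (_ , k′-minimal) , k<k′) with 2 ≤? card (P2×Pn (suc m)) E
... | yes many = many
... | no  few with few-edges-rdf m E few
...   | g , rdf-g , wg =
  contradiction (≤-trans k<k′ (subst (k′ ≤_) wg (k′-minimal g rdf-g))) (≤⇒≯ (rdf⇒weight≥ m h rdf-h))

-- Deleting the two rails between the first two columns

-- toℕ i + toℕ k ≡ 1 says that {i, k} = {0, 1}.
firstRail : ∀ {n} → Vertex n → Vertex n → Bool
firstRail (a , i) (b , k) = ⌊ a FinP.≟ b ⌋ ∧ (toℕ i + toℕ k ≡ᵇ 1)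

+≡1⇒consecutive : ∀ x y → x + y ≡ 1 → suc x ≡ y ⊎ suc y ≡ x
+≡1⇒consecutive zero          (suc zero) _ = inj₁ refl
+≡1⇒consecutive (suc zero)    zero       _ = inj₂ refl
+≡1⇒consecutive zero          zero ()
+≡1⇒consecutive zero          (suc (suc _)) ()
+≡1⇒consecutive (suc zero)    (suc _) ()
+≡1⇒consecutive (suc (suc _)) _ ()

firstRails : ∀ {n} → EdgeSet (P2×Pn n)
firstRails {n} = record { mem = firstRail ; sym = firstRail-sym ; subset = firstRail-adj }
  where
  firstRail-sym : ∀ u v → firstRail u v ≡ firstRail v u
  firstRail-sym (a , i) (b , k) = cong₂ _∧_ (≟-sym a b) (cong (_≡ᵇ 1) (+-comm (toℕ i) (toℕ k)))
    where
    ≟-sym : ∀ (a b : Fin 2) → ⌊ a FinP.≟ b ⌋ ≡ ⌊ b FinP.≟ a ⌋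
    ≟-sym zero       zero       = refl
    ≟-sym zero       (suc zero) = refl
    ≟-sym (suc zero) zero       = refl
    ≟-sym (suc zero) (suc zero) = refl
  firstRail-adj : ∀ u v → firstRail u v ≡ true → adj (P2×Pn n) u v ≡ true
  firstRail-adj (a , i) (b , k) h
    with ⌊⌋-sound (a FinP.≟ b) (proj₁ (∧-true h))
       | +≡1⇒consecutive (toℕ i) (toℕ k) (≡ᵇ⇒≡ _ 1 (subst T (sym (proj₂ (∧-true h))) tt))
  ... | refl | inj₁ s = Neighbour⇒adj (right a s)
  ... | refl | inj₂ s = Neighbour⇒adj (left a s)

card-firstRails : ∀ m → card (P2×Pn (suc (suc m))) firstRails ≡ 2
card-firstRails m =
  cong (_/ 2) (≤-antisym (unique⇒length≤ pairs-unique ⊆fourPairs) (unique⇒length≤ fourPairs-unique ⊆pairs))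
  where
  fourPairs : List (Vertex (suc (suc m)) × Vertex (suc (suc m)))
  fourPairs = ((zero , zero) , (zero , suc zero)) ∷ ((zero , suc zero) , (zero , zero))
            ∷ ((suc zero , zero) , (suc zero , suc zero)) ∷ ((suc zero , suc zero) , (suc zero , zero)) ∷ []
  fourPairs-unique : Unique fourPairs
  fourPairs-unique = ((λ ()) ∷ (λ ()) ∷ (λ ()) ∷ []) ∷ ((λ ()) ∷ (λ ()) ∷ []) ∷ ((λ ()) ∷ []) ∷ [] ∷ []
  pairs-unique : Unique (edgePairs firstRails)
  pairs-unique = Unique.filter⁺ (edgePair? firstRails) (Unique.cartesianProduct⁺ vertices-unique vertices-unique)
    where vertices-unique = Unique.cartesianProduct⁺ (Unique.allFin⁺ 2) (Unique.allFin⁺ (suc (suc m)))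
  ⊆pairs : ∀ {z} → z ∈ fourPairs → z ∈ edgePairs firstRails
  ⊆pairs (here refl)                         = ∈-edgePairs firstRails refl
  ⊆pairs (there (here refl))                 = ∈-edgePairs firstRails refl
  ⊆pairs (there (there (here refl)))         = ∈-edgePairs firstRails refl
  ⊆pairs (there (there (there (here refl)))) = ∈-edgePairs firstRails refl
  classify : ∀ r (i k : Fin (suc (suc m))) → (toℕ i + toℕ k ≡ᵇ 1) ≡ true → ((r , i) , (r , k)) ∈ fourPairs
  classify zero       zero       (suc zero) _ = here refl
  classify zero       (suc zero) zero       _ = there (here refl)
  classify (suc zero) zero       (suc zero) _ = there (there (here refl))
  classify (suc zero) (suc zero) zero       _ = there (there (there (here refl)))
  classify _ zero          zero          ()
  classify _ zero          (suc (suc _)) ()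
  classify _ (suc zero)    (suc _)       ()
  classify _ (suc (suc _)) _             ()
  ⊆fourPairs : ∀ {z} → z ∈ edgePairs firstRails → z ∈ fourPairs
  ⊆fourPairs {(a , i) , (b , k)} p with ∧-true {⌊ a FinP.≟ b ⌋} (edgePairs-mem firstRails p)
  ... | same , gap with ⌊⌋-sound (a FinP.≟ b) same
  ...   | refl = classify a i k gap

K₂-weight : ∀ a b → (a ≡ 0 → b ≡ 2) → (b ≡ 0 → a ≡ 2) → 2 ≤ a + b
K₂-weight zero    b       a₀ _  rewrite a₀ refl = ≤-refl
K₂-weight (suc a) zero    _  b₀ = ≤-reflexive (sym (trans (+-identityʳ (suc a)) (b₀ refl)))
K₂-weight (suc a) (suc b) _  _  = s≤s (subst (1 ≤_) (sym (+-suc a b)) (s≤s z≤n))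

module _ {m : ℕ} where

  private
    G  = P2×Pn (suc (suc m))
    G′ = deleteEdges G firstRails
    H  = P2×Pn (suc m)

  shift : Vertex (suc m) → Vertex (suc (suc m))
  shift (r , i) = r , suc i

  prepend : Column → (Vertex (suc m) → ℕ) → Vertex (suc (suc m)) → ℕ
  prepend c g (r , zero)  = entry r c
  prepend c g (r , suc i) = g (r , i)

  weight-split : ∀ f → weight G f ≡ columnWeight (column f zero) + weight H (f ∘ shift)
  weight-split f = trans (weight-columns f) (cong (columnWeight (column f zero) +_) (sym (weight-columns (f ∘ shift))))

  firstRail-shift : ∀ a b (i k : Fin (suc m)) → firstRail (a , suc i) (b , suc k) ≡ false
  firstRail-shift a b i k rewrite +-suc (toℕ i) (toℕ k) = ∧-zeroʳ ⌊ a FinP.≟ b ⌋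

  shift-neighbour : ∀ {u v} → Neighbour u v → Neighbour (shift u) (shift v)
  shift-neighbour (down i)    = down (suc i)
  shift-neighbour (up i)      = up (suc i)
  shift-neighbour (left r s)  = left r (cong suc s)
  shift-neighbour (right r s) = right r (cong suc s)

  unshift-neighbour : ∀ {r i b k} → Neighbour (r , suc i) (b , k) → firstRail (r , suc i) (b , k) ≡ false →
    Σ (Fin (suc m)) λ k′ → k ≡ suc k′ × Neighbour (r , i) (b , k′)
  unshift-neighbour (down (suc i))                     _ = i , refl , down i
  unshift-neighbour (up (suc i))                       _ = i , refl , up i
  unshift-neighbour (left r {suc i} {suc k} s)         _ = k , refl , left r (suc-injective s)
  unshift-neighbour (right r {suc i} {suc k} s)        _ = k , refl , right r (suc-injective s)
  unshift-neighbour (left zero {suc zero} {zero} _)    ()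
  unshift-neighbour (left (suc zero) {suc zero} {zero} _) ()
  unshift-neighbour (left r {suc (suc i)} {zero} ())

  rdf-tail : ∀ f → IsRDF G′ f → IsRDF H (f ∘ shift)
  rdf-tail f (bounds , dominated) = bounds ∘ shift , λ { (r , i) f₀ → unshift {r} {i} (dominated (r , suc i) f₀) }
    where
    unshift : ∀ {r i} → Σ (Vertex (suc (suc m))) (λ u → adj G′ (r , suc i) u ≡ true × f u ≡ 2) →
      Σ (Vertex (suc m)) λ u → adj H (r , i) u ≡ true × f (shift u) ≡ 2
    unshift {r} {i} ((b , k) , a , f₂) with deleteEdges-adj⁻ firstRails (r , suc i) (b , k) a
    ... | a′ , kept with unshift-neighbour (adj⇒Neighbour (r , suc i) (b , k) a′) kept
    ...   | k′ , refl , nb = (b , k′) , Neighbour⇒adj nb , f₂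

  rdf-head : ∀ f → IsRDF G′ f → 2 ≤ columnWeight (column f zero)
  rdf-head f (_ , dominated) = K₂-weight _ _ (partner zero) (partner (suc zero))
    where
    partner : ∀ r → f (r , zero) ≡ 0 → f (otherRow r , zero) ≡ 2
    partner r f₀ with dominated (r , zero) f₀
    ... | (b , k) , a , f₂ with deleteEdges-adj⁻ firstRails (r , zero) (b , k) a
    ...   | a′ , kept = from-neighbour (adj⇒Neighbour (r , zero) (b , k) a′) kept f₂
      where
      from-neighbour : ∀ {r b k} → Neighbour (r , zero) (b , k) → firstRail (r , zero) (b , k) ≡ false →
        f (b , k) ≡ 2 → f (otherRow r , zero) ≡ 2
      from-neighbour (down _) _ f₂ = f₂
      from-neighbour (up _)   _ f₂ = f₂
      from-neighbour (right zero       {k = suc zero} _) () _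
      from-neighbour (right (suc zero) {k = suc zero} _) () _
      from-neighbour (right _ {k = suc (suc _)} ()) _ _

  rdf-prepend : ∀ g → IsRDF H g → IsRDF G′ (prepend (2 , 0) g)
  rdf-prepend g (bounds , dominated) = bounds′ , dominated′
    where
    bounds′ : ∀ v → prepend (2 , 0) g v ≤ 2
    bounds′ (zero , zero)     = ≤-refl
    bounds′ (suc zero , zero) = z≤n
    bounds′ (r , suc i)       = bounds (r , i)
    dominated′ : ∀ v → prepend (2 , 0) g v ≡ 0 →
      Σ (Vertex (suc (suc m))) λ u → adj G′ v u ≡ true × prepend (2 , 0) g u ≡ 2
    dominated′ (zero , zero) ()
    dominated′ (suc zero , zero) _ = (zero , zero) , deleteEdges-adj⁺ {suc (suc m)} firstRails (up zero) refl , refl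
    dominated′ (r , suc i) g₀ with dominated (r , i) g₀
    ... | (b , k) , a , g₂ =
      (b , suc k) ,
      deleteEdges-adj⁺ firstRails (shift-neighbour (adj⇒Neighbour (r , i) (b , k) a)) (firstRail-shift r b i k) ,
      g₂

γR-without-firstRails : ∀ m → IsRomanDomNum (deleteEdges (P2×Pn (suc (suc m))) firstRails) (4 + m)
γR-without-firstRails m with γR-P2×Pn m
... | (g , rdf-g , wg) , _ =
  (prepend (2 , 0) g , rdf-prepend g rdf-g , trans (weight-split (prepend (2 , 0) g)) (cong (2 +_) wg)) ,
  λ f rdf → subst (4 + m ≤_) (sym (weight-split f)) (+-mono-≤ (rdf-head f rdf) (rdf⇒weight≥ m _ (rdf-tail f rdf)))

theorem10 : (n : ℕ) → 2 ≤ n → IsRomanBondageNum (P2×Pn n) 2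
theorem10 (suc zero)    (s≤s ())
theorem10 (suc (suc m)) _ =
  (firstRails , card-firstRails m , (3 + m , 4 + m , γR-P2×Pn (suc m) , γR-without-firstRails m , ≤-refl)) ,
  raising⇒2≤card (suc m)
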